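{- Let $G$ be a Meyniel graph and $\mathcal{Q}$ a pre-co-coloring of $G$. Then the co-contracted graph $G^{\mathcal{Q}}$ contains no antihole with at least $6$ vertices as an induced subgraph.
   Context: All graphs are finite and simple. A pre-co-coloring of $G$ is a collection $\mathcal{Q}=\{C_1,\ldots,C_m\}$ of pairwise disjoint cliques of $G$. The co-contracted graph $G^{\mathcal{Q}}$ is obtained from $G$ by contracting each $C_j$ into a single vertex $c_j$, where a vertex of $V(G)\setminus(C_1\cup\cdots\cup C_m)$ is adjacent to $c_j$ if and only if it is adjacent in $G$ to every vertex of $C_j$, there is no edge between any two $c_j$'s, and other adjacencies are as in $G$. A hole is a chordless cycle of length at least $4$; an antihole is the complement of a hole. A Meyniel graph is a graph in which every odd cycle has at least two chords; equivalently, a graph with no induced odd hole and no induced house (a cycle of length at least five whose only chord joins two vertices at distance two on the cycle). -}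

module Defs where

open import Data.Nat using (ℕ; zero; suc; _≤_; _<_; _%_)
open import Data.Fin using (Fin; toℕ)
open import Data.Maybe using (Maybe; just; nothing)
open import Data.Product using (Σ; ∃; _×_; _,_)
open import Data.Sum using (_⊎_; inj₁; inj₂)
open import Data.Empty using (⊥)
open import Relation.Nullary using (¬_)
open import Relation.Binary.PropositionalEquality using (_≡_; refl)
open import Function.Definitions using (Injective)
open import Function.Bundles using (_⇔_)

record Graph (V : Set) : Set₁ where
  field
    Adj    : V → V → Set
    symm   : ∀ {u v} → Adj u v → Adj v u
    irrefl : ∀ {v} → ¬ Adj v v
open Graph public

CycAdj : (k : ℕ) → Fin k → Fin k → Set
CycAdj k i j =
    suc (toℕ i) ≡ toℕ j
  ⊎ suc (toℕ j) ≡ toℕ i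
  ⊎ (toℕ i ≡ 0 × suc (toℕ j) ≡ k)
  ⊎ (toℕ j ≡ 0 × suc (toℕ i) ≡ k)

record Cycle {V : Set} (G : Graph V) (k : ℕ) : Set where
  field
    len≥3   : 3 ≤ k
    vtx     : Fin k → V
    vtx-inj : Injective _≡_ _≡_ vtx
    edges   : ∀ i j → CycAdj k i j → Adj G (vtx i) (vtx j)
open Cycle public

Chord : {V : Set} {G : Graph V} {k : ℕ} → Cycle G k → Fin k → Fin k → Set
Chord {G = G} {k} C i j = toℕ i < toℕ j × ¬ CycAdj k i j × Adj G (vtx C i) (vtx C j)

HasTwoChords : {V : Set} {G : Graph V} {k : ℕ} → Cycle G k → Set
HasTwoChords {k = k} C =
  Σ (Fin k) λ i → Σ (Fin k) λ j → Σ (Fin k) λ i' → Σ (Fin k) λ j' →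
    Chord C i j × Chord C i' j' × ¬ ((i ≡ i') × (j ≡ j'))

Meyniel : {V : Set} → Graph V → Set
Meyniel G = ∀ k → k % 2 ≡ 1 → 5 ≤ k → (C : Cycle G k) → HasTwoChords C

-- A pre-co-coloring with m cliques C_0,...,C_{m-1} of a graph on Fin n, encoded by
-- the partial labelling  label v = just j  iff  v ∈ C_j  (this encodes disjointness).
record PreCoColoring {n : ℕ} (G : Graph (Fin n)) (m : ℕ) : Set where
  field
    label    : Fin n → Maybe (Fin m)
    nonempty : ∀ j → ∃ λ v → label v ≡ just j
    clique   : ∀ u v j → label u ≡ just j → label v ≡ just j → ¬ u ≡ v → Adj G u v
open PreCoColoring public

-- Vertices of the co-contracted graph: uncovered vertices of G, plus one vertex c_j per clique.
CoVertex : {n m : ℕ} {G : Graph (Fin n)} → PreCoColoring G m → Set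
CoVertex {n} {m} Q = (Σ (Fin n) λ v → label Q v ≡ nothing) ⊎ Fin m

CoAdj : {n m : ℕ} {G : Graph (Fin n)} (Q : PreCoColoring G m) → CoVertex Q → CoVertex Q → Set
CoAdj {G = G} Q (inj₁ (u , _)) (inj₁ (v , _)) = Adj G u v
CoAdj {G = G} Q (inj₁ (u , _)) (inj₂ j) = ∀ v → label Q v ≡ just j → Adj G u v
CoAdj {G = G} Q (inj₂ j) (inj₁ (u , _)) = ∀ v → label Q v ≡ just j → Adj G u v
CoAdj Q (inj₂ _) (inj₂ _) = ⊥

private
  coSym : {n m : ℕ} {G : Graph (Fin n)} (Q : PreCoColoring G m) →
          ∀ {x y} → CoAdj Q x y → CoAdj Q y x
  coSym {G = G} Q {inj₁ _} {inj₁ _} a = symm G a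
  coSym Q {inj₁ _} {inj₂ _} a = a
  coSym Q {inj₂ _} {inj₁ _} a = a
  coSym Q {inj₂ _} {inj₂ _} ()

  coIrr : {n m : ℕ} {G : Graph (Fin n)} (Q : PreCoColoring G m) →
          ∀ {x} → ¬ CoAdj Q x x
  coIrr {G = G} Q {inj₁ _} a = irrefl G a
  coIrr Q {inj₂ _} ()

coContract : {n m : ℕ} {G : Graph (Fin n)} (Q : PreCoColoring G m) → Graph (CoVertex Q)
coContract Q = record { Adj = CoAdj Q ; symm = λ {x} {y} → coSym Q {x} {y} ; irrefl = λ {x} → coIrr Q {x} }

record InducedAntihole {V : Set} (G : Graph V) (k : ℕ) : Set where
  field
    len≥4 : 4 ≤ k
    vtx   : Fin k → V
    vtx-inj : Injective _≡_ _≡_ vtx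
    adj⇔  : ∀ i j → ¬ i ≡ j → Adj G (vtx i) (vtx j) ⇔ (¬ CycAdj k i j)

module Submission where

-- Two contracted vertices of G^Q are never adjacent.  So either no vertex of the antihole is
-- contracted, or after rotating the antihole position 0 holds one and positions 2, 3, 4,
-- being adjacent to it, do not.  As k ≥ 6, positions 1, 3, 5, 2, 4 span a 5-cycle of G^Q whose
-- only possible chord joins 1 and 5.  Replacing 1 and 5 by vertices of G they stand for that
-- are non-adjacent to 2 and to 4 respectively lifts it to a 5-cycle of G with at most one
-- chord, which a Meyniel graph does not have.

open import Defs
open import Data.Nat using (ℕ; zero; suc; _≤_; _+_; s≤s; z≤n)
import Data.Nat as ℕ
open import Data.Nat.Properties using (_<?_; suc-injective; <-irrefl; ≮⇒≥; ≤-antisym; 1+n≢0; ≤-refl)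
import Data.Fin as Fin
open import Data.Fin using (Fin; zero; suc; toℕ; fromℕ<; inject₁; _<_)
open import Data.Fin.Properties using (toℕ-injective; toℕ-fromℕ<; toℕ<n; toℕ-inject₁; <-cmp; any?; sequence)
open import Data.Fin.Induction using (<-weakInduction)
open import Data.Fin.Patterns
open import Data.Product using (Σ; ∃; _×_; _,_)
open import Data.Sum using (_⊎_; inj₁; inj₂; [_,_])
import Data.Sum as Sum
open import Data.Empty using (⊥; ⊥-elim)
open import Data.Unit using (⊤; tt)
open import Data.Maybe using (just)
open import Effect.Monad using (RawMonad)
open import Function.Definitions using (Injective)
open import Relation.Binary.Definitions using (tri<; tri≈; tri>)
open import Function using (_∘_)
open import Function.Bundles using (_⇔_; mk⇔; Equivalence)
open import Relation.Nullary using (Dec; yes; no; ¬_)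
open import Relation.Nullary.Decidable using (True; False; toWitness; toWitnessFalse; _×-dec_; _⊎-dec_)
open import Relation.Nullary.Negation using (¬¬-Monad; ¬¬-map)
open import Relation.Binary.PropositionalEquality using (_≡_; _≢_; refl; sym; trans; cong; subst)

open Equivalence using (to; from)
open InducedAntihole using (vtx; vtx-inj; adj⇔; len≥4)

private variable
  k : ℕ

sucᶜ : Fin k → Fin k
sucᶜ {suc n} i with suc (toℕ i) <? suc n
... | yes i+1<k = fromℕ< i+1<k
... | no  _     = zero

Next : (k : ℕ) → Fin k → Fin k → Set
Next k i j = suc (toℕ i) ≡ toℕ j ⊎ (toℕ j ≡ 0 × suc (toℕ i) ≡ k)

next⇔≡sucᶜ : {i j : Fin k} → Next k i j ⇔ j ≡ sucᶜ i
next⇔≡sucᶜ {suc n} {i} {j} = mk⇔ next⇒ next⇐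
  where
  next⇒ : Next (suc n) i j → j ≡ sucᶜ i
  next⇒ nx with suc (toℕ i) <? suc n | nx
  ... | yes i+1<k | inj₁ i+1≡j       = toℕ-injective (trans (sym i+1≡j) (sym (toℕ-fromℕ< i+1<k)))
  ... | yes i+1<k | inj₂ (_ , i+1≡k) = ⊥-elim (<-irrefl i+1≡k i+1<k)
  ... | no  i+1≮k | inj₁ i+1≡j       = ⊥-elim (i+1≮k (subst (ℕ._< suc n) (sym i+1≡j) (toℕ<n j)))
  ... | no  _     | inj₂ (j≡0 , _)   = toℕ-injective j≡0
  next⇐ : j ≡ sucᶜ i → Next (suc n) i j
  next⇐ refl with suc (toℕ i) <? suc n
  ... | yes i+1<k = inj₁ (sym (toℕ-fromℕ< i+1<k))
  ... | no  i+1≮k = inj₂ (refl , ≤-antisym (toℕ<n i) (≮⇒≥ i+1≮k))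

next-injective : {i i′ j : Fin k} → Next k i j → Next k i′ j → i ≡ i′
next-injective (inj₁ i+1≡j)       (inj₁ i′+1≡j)       =
  toℕ-injective (suc-injective (trans i+1≡j (sym i′+1≡j)))
next-injective (inj₂ (_ , i+1≡k)) (inj₂ (_ , i′+1≡k)) =
  toℕ-injective (suc-injective (trans i+1≡k (sym i′+1≡k)))
next-injective (inj₁ i+1≡j)       (inj₂ (j≡0 , _))    = ⊥-elim (1+n≢0 (trans i+1≡j j≡0))
next-injective (inj₂ (j≡0 , _))   (inj₁ i′+1≡j)       = ⊥-elim (1+n≢0 (trans i′+1≡j j≡0))

sucᶜ-injective : {i j : Fin k} → sucᶜ i ≡ sucᶜ j → i ≡ j
sucᶜ-injective e = next-injective (from next⇔≡sucᶜ (sym e)) (from next⇔≡sucᶜ refl)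

sucᶜ-inject₁ : (i : Fin k) → sucᶜ (inject₁ i) ≡ suc i
sucᶜ-inject₁ i = sym (to next⇔≡sucᶜ (inj₁ (cong suc (toℕ-inject₁ i))))

cycAdj⇔ : {i j : Fin k} → CycAdj k i j ⇔ (j ≡ sucᶜ i ⊎ i ≡ sucᶜ j)
cycAdj⇔ = mk⇔ (Sum.map (to next⇔≡sucᶜ) (to next⇔≡sucᶜ) ∘ split)
              (join ∘ Sum.map (from next⇔≡sucᶜ) (from next⇔≡sucᶜ))
  where
  split : ∀ {i j} → CycAdj k i j → Next k i j ⊎ Next k j i
  split (inj₁ i+1≡j)               = inj₁ (inj₁ i+1≡j)
  split (inj₂ (inj₁ j+1≡i))        = inj₂ (inj₁ j+1≡i)
  split (inj₂ (inj₂ (inj₁ wrap)))  = inj₂ (inj₂ wrap)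
  split (inj₂ (inj₂ (inj₂ wrap)))  = inj₁ (inj₂ wrap)
  join : ∀ {i j} → Next k i j ⊎ Next k j i → CycAdj k i j
  join (inj₁ (inj₁ i+1≡j)) = inj₁ i+1≡j
  join (inj₁ (inj₂ wrap))  = inj₂ (inj₂ (inj₂ wrap))
  join (inj₂ (inj₁ j+1≡i)) = inj₂ (inj₁ j+1≡i)
  join (inj₂ (inj₂ wrap))  = inj₂ (inj₂ (inj₁ wrap))

cycAdj-sucᶜ : {i j : Fin k} → CycAdj k (sucᶜ i) (sucᶜ j) ⇔ CycAdj k i j
cycAdj-sucᶜ = mk⇔ (from cycAdj⇔ ∘ Sum.map sucᶜ-injective sucᶜ-injective ∘ to cycAdj⇔)
                  (from cycAdj⇔ ∘ Sum.map (cong sucᶜ) (cong sucᶜ) ∘ to cycAdj⇔)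

cycAdj? : ∀ k (i j : Fin k) → Dec (CycAdj k i j)
cycAdj? k i j = suc (toℕ i) ℕ.≟ toℕ j ⊎-dec suc (toℕ j) ℕ.≟ toℕ i
  ⊎-dec (toℕ i ℕ.≟ 0 ×-dec suc (toℕ j) ℕ.≟ k) ⊎-dec (toℕ j ℕ.≟ 0 ×-dec suc (toℕ i) ℕ.≟ k)

consecutive : (i j : Fin k) → {True (cycAdj? k i j)} → CycAdj k i j
consecutive i j {cyc} = toWitness cyc

<⇒≢⇒injective : {A : Set} {f : Fin k → A} →
                (∀ {i j} → i < j → f i ≢ f j) → Injective _≡_ _≡_ f
<⇒≢⇒injective distinct {i} {j} fi≡fj with <-cmp i j
... | tri< i<j _ _ = ⊥-elim (distinct i<j fi≡fj)
... | tri≈ _ i≡j _ = i≡j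
... | tri> _ _ j<i = ⊥-elim (distinct j<i (sym fi≡fj))

module _ {V : Set} (G : Graph V) where

  adj⇒≢ : ∀ {x y} → Adj G x y → x ≢ y
  adj⇒≢ xy refl = irrefl G xy

  adj-separates : ∀ {x y w} → Adj G x w → ¬ Adj G y w → x ≢ y
  adj-separates xw ¬yw refl = ¬yw xw

module _ {V : Set} {G : Graph V} where

  mkCycle : (f : Fin k → V) → Injective _≡_ _≡_ f → 3 ≤ k →
            (∀ i → Adj G (f i) (f (sucᶜ i))) → Cycle G k
  mkCycle f f-injective 3≤k step = record
    { len≥3   = 3≤k
    ; vtx     = f
    ; vtx-inj = f-injective
    ; edges   = λ i j → [ (λ { refl → step i }) , (λ { refl → symm G (step j) }) ] ∘ to cycAdj⇔
    }

record Pentagon {V : Set} (G : Graph V) (a b c d e : V) : Set where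
  field
    ab  : Adj G a b
    bc  : Adj G b c
    cd  : Adj G c d
    de  : Adj G d e
    ea  : Adj G e a
    ¬ad : ¬ Adj G a d
    ¬bd : ¬ Adj G b d
    ¬be : ¬ Adj G b e
    ¬ce : ¬ Adj G c e

module _ {V : Set} {G : Graph V} {a b c d e : V} (P : Pentagon G a b c d e) where
  open Pentagon P

  private
    vertex : Fin 5 → V
    vertex 0F = a
    vertex 1F = b
    vertex 2F = c
    vertex 3F = d
    vertex 4F = e

    distinct : ∀ {i j} → i < j → vertex i ≢ vertex j
    distinct {0F} {1F} _ = adj⇒≢ G ab
    distinct {0F} {2F} _ = adj-separates G (symm G ea) ¬ce
    distinct {0F} {3F} _ = adj-separates G ab (¬bd ∘ symm G)
    distinct {0F} {4F} _ = adj⇒≢ G (symm G ea)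
    distinct {1F} {2F} _ = adj⇒≢ G bc
    distinct {1F} {3F} _ = adj-separates G (symm G ab) (¬ad ∘ symm G)
    distinct {1F} {4F} _ = adj-separates G bc (¬ce ∘ symm G)
    distinct {2F} {3F} _ = adj⇒≢ G cd
    distinct {2F} {4F} _ = adj-separates G (symm G bc) (¬be ∘ symm G)
    distinct {3F} {4F} _ = adj⇒≢ G de
    distinct {_} {0F} ()
    distinct {suc _} {1F} (s≤s ())
    distinct {suc (suc _)} {2F} (s≤s (s≤s ()))
    distinct {suc (suc (suc _))} {3F} (s≤s (s≤s (s≤s ())))
    distinct {4F} {4F} (s≤s (s≤s (s≤s (s≤s ()))))

    step : ∀ i → Adj G (vertex i) (vertex (sucᶜ i))
    step 0F = ab
    step 1F = bc
    step 2F = cd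
    step 3F = de
    step 4F = ea

  pentagonCycle : Cycle G 5
  pentagonCycle = mkCycle vertex (<⇒≢⇒injective distinct) (s≤s (s≤s (s≤s z≤n))) step

  pentagonCycle-chord : ∀ {i j} → Chord pentagonCycle i j → i ≡ 0F × j ≡ 2F
  pentagonCycle-chord {0F} {2F} _ = refl , refl
  pentagonCycle-chord {0F} {3F} (_ , _ , ad) = ⊥-elim (¬ad ad)
  pentagonCycle-chord {1F} {3F} (_ , _ , bd) = ⊥-elim (¬bd bd)
  pentagonCycle-chord {1F} {4F} (_ , _ , be) = ⊥-elim (¬be be)
  pentagonCycle-chord {2F} {4F} (_ , _ , ce) = ⊥-elim (¬ce ce)
  pentagonCycle-chord {0F} {1F} (_ , ¬cyc , _) = ⊥-elim (¬cyc (consecutive 0F 1F))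
  pentagonCycle-chord {1F} {2F} (_ , ¬cyc , _) = ⊥-elim (¬cyc (consecutive 1F 2F))
  pentagonCycle-chord {2F} {3F} (_ , ¬cyc , _) = ⊥-elim (¬cyc (consecutive 2F 3F))
  pentagonCycle-chord {3F} {4F} (_ , ¬cyc , _) = ⊥-elim (¬cyc (consecutive 3F 4F))
  pentagonCycle-chord {0F} {4F} (_ , ¬cyc , _) = ⊥-elim (¬cyc (consecutive 0F 4F))
  pentagonCycle-chord {_} {0F} (() , _)
  pentagonCycle-chord {suc _} {1F} (s≤s () , _)
  pentagonCycle-chord {suc (suc _)} {2F} (s≤s (s≤s ()) , _)
  pentagonCycle-chord {suc (suc (suc _))} {3F} (s≤s (s≤s (s≤s ())) , _)
  pentagonCycle-chord {4F} {4F} (s≤s (s≤s (s≤s (s≤s ()))) , _)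

Meyniel⇒¬Pentagon : {V : Set} {G : Graph V} → Meyniel G → ∀ {a b c d e} → ¬ Pentagon G a b c d e
Meyniel⇒¬Pentagon M P with M 5 refl ≤-refl (pentagonCycle P)
... | _ , _ , _ , _ , ij , i′j′ , distinct-chords
  with pentagonCycle-chord P ij | pentagonCycle-chord P i′j′
... | refl , refl | refl , refl = distinct-chords (refl , refl)

module _ {V : Set} {H : Graph V} where

  rotate : InducedAntihole H k → InducedAntihole H k
  rotate A = record
    { len≥4   = len≥4 A
    ; vtx     = vtx A ∘ sucᶜ
    ; vtx-inj = sucᶜ-injective ∘ vtx-inj A
    ; adj⇔    = λ i j i≢j → let A⇔ = adj⇔ A (sucᶜ i) (sucᶜ j) (i≢j ∘ sucᶜ-injective) in
        mk⇔ (λ adj → to A⇔ adj ∘ from cycAdj-sucᶜ) (λ ¬cyc → from A⇔ (¬cyc ∘ to cycAdj-sucᶜ))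
    }

  rotateTo : ∀ {n} (A : InducedAntihole H (suc n)) (s : Fin (suc n)) →
             Σ (InducedAntihole H (suc n)) λ A′ → vtx A′ 0F ≡ vtx A s
  rotateTo {n} A s = <-weakInduction P (λ A → A , refl) step s A
    where
    P : Fin (suc n) → Set
    P s = ∀ A → Σ (InducedAntihole H (suc n)) λ A′ → vtx A′ 0F ≡ vtx A s
    step : ∀ i → P (inject₁ i) → P (suc i)
    step i rotate-to-i A with rotate-to-i (rotate A)
    ... | A′ , A′₀≡ = A′ , trans A′₀≡ (cong (vtx A) (sucᶜ-inject₁ i))

  -- At numeral positions the implicit side conditions evaluate to ⊤, even for a symbolic k.
  antihole-adj : (A : InducedAntihole H k) (i j : Fin k) →
                 {False (i Fin.≟ j)} → {False (cycAdj? k i j)} → Adj H (vtx A i) (vtx A j)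
  antihole-adj A i j {i≢j} {¬cyc} = from (adj⇔ A i j (toWitnessFalse i≢j)) (toWitnessFalse ¬cyc)

  antihole-¬adj : (A : InducedAntihole H k) (i j : Fin k) →
                  {False (i Fin.≟ j)} → {True (cycAdj? k i j)} → ¬ Adj H (vtx A i) (vtx A j)
  antihole-¬adj A i j {i≢j} {cyc} adj = to (adj⇔ A i j (toWitnessFalse i≢j)) adj (toWitness cyc)

  antihole⇒pentagon : (A : InducedAntihole H (6 + k)) →
                      Pentagon H (vtx A 1F) (vtx A 3F) (vtx A 5F) (vtx A 2F) (vtx A 4F)
  antihole⇒pentagon A = record
    { ab  = antihole-adj A 1F 3F
    ; bc  = antihole-adj A 3F 5F
    ; cd  = antihole-adj A 5F 2F
    ; de  = antihole-adj A 2F 4F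
    ; ea  = antihole-adj A 4F 1F
    ; ¬ad = antihole-¬adj A 1F 2F
    ; ¬bd = antihole-¬adj A 3F 2F
    ; ¬be = antihole-¬adj A 3F 4F
    ; ¬ce = antihole-¬adj A 5F 4F
    }

¬∀⇒¬¬∃ : ∀ {n} {P R : Fin n → Set} → ¬ (∀ i → P i → R i) → ¬ ¬ ∃ λ i → P i × ¬ R i
¬∀⇒¬¬∃ ¬∀ ¬∃ = sequence (RawMonad.rawApplicative ¬¬-Monad) ¬¬P⇒R ¬∀
  where
  ¬¬P⇒R : ∀ i → ¬ ¬ (_ → _)
  ¬¬P⇒R i ¬P⇒R = ¬P⇒R (λ p → ⊥-elim (¬∃ (i , p , λ r → ¬P⇒R (λ _ → r))))

module _ {n m : ℕ} {G : Graph (Fin n)} {Q : PreCoColoring G m} where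

  _∈ᶜ_ : Fin n → CoVertex Q → Set
  g ∈ᶜ inj₁ (v , _) = g ≡ v
  g ∈ᶜ inj₂ j       = label Q g ≡ just j

  Contracted : CoVertex Q → Set
  Contracted (inj₁ _) = ⊥
  Contracted (inj₂ _) = ⊤

  contracted? : (x : CoVertex Q) → Dec (Contracted x)
  contracted? (inj₁ _) = no λ ()
  contracted? (inj₂ _) = yes tt

  contracted-¬coAdj : ∀ {x y} → Contracted x → Contracted y → ¬ CoAdj Q x y
  contracted-¬coAdj {inj₂ _} {inj₂ _} _ _ ()

  coAdj⇒adj : ∀ x y {g h} → CoAdj Q x y → g ∈ᶜ x → h ∈ᶜ y → Adj G g h
  coAdj⇒adj (inj₁ _) (inj₁ _) xy refl refl = xy
  coAdj⇒adj (inj₁ _) (inj₂ _) xy refl h∈y  = xy _ h∈y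
  coAdj⇒adj (inj₂ _) (inj₁ _) xy g∈x refl  = symm G (xy _ g∈x)

  -- Adjacency in G is not decidable, so the non-neighbour is only found under double negation;
  -- this is enough, as it is used to derive ⊥.
  ¬coAdj⇒¬¬nonNeighbour : ∀ x {v p} → ¬ CoAdj Q x (inj₁ (v , p)) →
                          ¬ ¬ ∃ λ g → g ∈ᶜ x × ¬ Adj G g v
  ¬coAdj⇒¬¬nonNeighbour (inj₁ (u , _)) ¬uv none = none (u , refl , ¬uv)
  ¬coAdj⇒¬¬nonNeighbour (inj₂ _)       ¬xv     =
    ¬¬-map (λ (g , g∈x , ¬vg) → g , g∈x , ¬vg ∘ symm G) (¬∀⇒¬¬∃ ¬xv)

  Meyniel⇒¬coPentagon : Meyniel G → ∀ {a b c d e} →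
                        ¬ Contracted b → ¬ Contracted d → ¬ Contracted e →
                        ¬ Pentagon (coContract Q) a b c d e
  Meyniel⇒¬coPentagon _ {b = inj₂ _} ¬Cb _ _ _ = ¬Cb tt
  Meyniel⇒¬coPentagon _ {d = inj₂ _} _ ¬Cd _ _ = ¬Cd tt
  Meyniel⇒¬coPentagon _ {e = inj₂ _} _ _ ¬Ce _ = ¬Ce tt
  Meyniel⇒¬coPentagon M {a} {b@(inj₁ _)} {c} {d@(inj₁ _)} {e@(inj₁ _)} _ _ _ P =
    ¬coAdj⇒¬¬nonNeighbour a ¬ad λ (g , g∈a , ¬gd) →
    ¬coAdj⇒¬¬nonNeighbour c ¬ce λ (h , h∈c , ¬he) →
    Meyniel⇒¬Pentagon M record
      { ab  = coAdj⇒adj a b ab g∈a refl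
      ; bc  = coAdj⇒adj b c bc refl h∈c
      ; cd  = coAdj⇒adj c d cd h∈c refl
      ; de  = de
      ; ea  = coAdj⇒adj e a ea refl g∈a
      ; ¬ad = ¬gd
      ; ¬bd = ¬bd
      ; ¬be = ¬be
      ; ¬ce = ¬he
      }
    where open Pentagon P

module _ {n m : ℕ} {G : Graph (Fin n)} (M : Meyniel G) {Q : PreCoColoring G m} {k : ℕ}
         (A : InducedAntihole (coContract Q) (6 + k)) where

  uncontracted-2-3-4⇒⊥ : ¬ Contracted (vtx A 2F) → ¬ Contracted (vtx A 3F) →
                         ¬ Contracted (vtx A 4F) → ⊥
  uncontracted-2-3-4⇒⊥ ¬C₂ ¬C₃ ¬C₄ = Meyniel⇒¬coPentagon M ¬C₃ ¬C₂ ¬C₄ (antihole⇒pentagon A)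

  contracted-0⇒⊥ : Contracted (vtx A 0F) → ⊥
  contracted-0⇒⊥ C₀ = uncontracted-2-3-4⇒⊥
    (λ C₂ → contracted-¬coAdj C₀ C₂ (antihole-adj A 0F 2F))
    (λ C₃ → contracted-¬coAdj C₀ C₃ (antihole-adj A 0F 3F))
    (λ C₄ → contracted-¬coAdj C₀ C₄ (antihole-adj A 0F 4F))

lemma7 : {n m : ℕ} (G : Graph (Fin n)) → Meyniel G → (Q : PreCoColoring G m) →
         ∀ k → 6 ≤ k → ¬ InducedAntihole (coContract Q) k
lemma7 G M Q _ (s≤s (s≤s (s≤s (s≤s (s≤s (s≤s _)))))) A with any? (contracted? ∘ vtx A)
... | no ¬∃C = uncontracted-2-3-4⇒⊥ M A (¬∃C ∘ (2F ,_)) (¬∃C ∘ (3F ,_)) (¬∃C ∘ (4F ,_))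
... | yes (s , Cₛ) with rotateTo A s
...   | A′ , A′₀≡Aₛ = contracted-0⇒⊥ M A′ (subst Contracted (sym A′₀≡Aₛ) Cₛ)
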